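{- Let $\Gamma$ be a finite abelian group of order $n$, $A=-A\subseteq\Gamma\setminus\{0\}$, $G=G(\Gamma,A)$ the Cayley graph, $\chi$ a nontrivial character of $\Gamma$ with $m=|\chi(\Gamma)|$, and $\rho:\Gamma\to\mathbb{Z}/m\mathbb{Z}$ the homomorphism with $\chi(\gamma)=e^{2\pi i\rho(\gamma)/m}$. Let $\ell,s,t$ be integers with $0\le s<s+\ell\le t<t+\ell\le m/2$, and put $d_1=t-s-\ell$, $d_2=t-s+\ell$. Then $$\frac mn\,e\big(\rho^{ -1}([s,s+\ell)),\rho^{ -1}([t,t+\ell))\big)=\sum_{d_1<f<t-s}|A\cap\rho^{ -1}(f)|(f-d_1)+\sum_{t-s\le f<d_2}|A\cap\rho^{ -1}(f)|(d_2-f),$$ where the sums run over integers $f$.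
   Context: The Cayley graph $G(\Gamma,A)$ has vertex set $\Gamma$, with $\gamma,\gamma'$ adjacent iff $\gamma'-\gamma\in A$. A character is a homomorphism $\Gamma\to S^1\subset\mathbb{C}$. For an integer $f$, $\rho^{ -1}(f)$ means $\rho^{ -1}(f\bmod m)$; for integers $D_1\le D_2$, $\rho^{ -1}([D_1,D_2))$ is the set of $\gamma$ with $\rho(\gamma)\equiv f\pmod m$ for some integer $D_1\le f<D_2$. For disjoint $U,W\subseteq\Gamma$, $e(U,W)$ is the number of edges of $G$ with one endpoint in $U$ and the other in $W$. -}

module Defs where

open import Data.Nat using (ℕ; zero; suc; _+_; _*_; _∸_; _≡ᵇ_; NonZero)
open import Data.Nat.DivMod using (_%_)
open import Data.Fin using (Fin; toℕ)
open import Data.Fin.Subset using (Subset; _∈_; _∉_)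
open import Data.Fin.Subset.Properties using (_∈?_)
open import Data.Vec using (tabulate)
open import Data.List using (List; map; upTo; allFin)
open import Data.Nat.ListAction using (sum)
open import Data.Bool.ListAction using (any)
open import Data.Bool using (Bool; true; false; if_then_else_; _∧_)
open import Data.Product using (∃)
open import Relation.Nullary.Decidable using (⌊_⌋)
open import Relation.Binary.PropositionalEquality using (_≡_)
open import Algebra.Structures using (IsAbelianGroup)

-- A finite abelian group of order n, with carrier Fin n (every finite
-- abelian group of order n is isomorphic to one of this form).
record FinAbGroup (n : ℕ) : Set where
  infixl 7 _∙_
  infix 8 _⁻¹
  field
    _∙_ : Fin n → Fin n → Fin n
    ε : Fin n
    _⁻¹ : Fin n → Fin n
    isAbelianGroup : IsAbelianGroup _≡_ _∙_ ε _⁻¹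

module _ {n : ℕ} (Γ : FinAbGroup n) where
  open FinAbGroup Γ

  Symmetric : Subset n → Set
  Symmetric A = ∀ g → g ∈ A → g ⁻¹ ∈ A

  IsHomToZmod : (m : ℕ) .{{_ : NonZero m}} → (Fin n → Fin m) → Set
  IsHomToZmod m ρ = ∀ a b → toℕ (ρ (a ∙ b)) ≡ (toℕ (ρ a) + toℕ (ρ b)) % m

  adjᵇ : Subset n → Fin n → Fin n → Bool
  adjᵇ A g g' = ⌊ (g' ∙ g ⁻¹) ∈? A ⌋

  -- e(U,W) for disjoint U, W: number of edges {u,w} with u ∈ U, w ∈ W
  -- (each such edge corresponds to exactly one ordered pair (u,w) ∈ U × W).
  edges : Subset n → Subset n → Subset n → ℕ
  edges A U W =
    sum (map (λ g → sum (map (λ g' →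
      if ⌊ g ∈? U ⌋ ∧ ⌊ g' ∈? W ⌋ ∧ adjᵇ A g g' then 1 else 0)
      (allFin n))) (allFin n))

-- integers f with D₁ ≤ f < D₂ (here all relevant integers are ≥ 0)
range : ℕ → ℕ → List ℕ
range D₁ D₂ = map (D₁ +_) (upTo (D₂ ∸ D₁))

sumRange : ℕ → ℕ → (ℕ → ℕ) → ℕ
sumRange D₁ D₂ h = sum (map h (range D₁ D₂))

preimage : {n m : ℕ} .{{_ : NonZero m}} → (Fin n → Fin m) → ℕ → Subset n
preimage {m = m} ρ f = tabulate (λ g → toℕ (ρ g) ≡ᵇ (f % m))

preimageRange : {n m : ℕ} .{{_ : NonZero m}} → (Fin n → Fin m) → ℕ → ℕ → Subset n
preimageRange {m = m} ρ D₁ D₂ =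
  tabulate (λ g → any (λ f → toℕ (ρ g) ≡ᵇ (f % m)) (range D₁ D₂))

module Submission where

-- Lemma A.10.  Write α(b) ∈ {0,1} for b ∈ A.  Counting the edges γ ~ γ' of
-- the Cayley graph by their difference b = γ' − γ gives
--     e(U, W) = Σ_b α(b) · #{γ ∈ U : b + γ ∈ W}.
-- The fibres of the surjective homomorphism ρ all have n/m elements, so for
-- U, W the preimages of [s, s+ℓ) and [t, t+ℓ) the inner count times m is
-- n · crossings(ρ b), where crossings(x) counts the y ∈ [s, s+ℓ) with
-- x + y mod m ∈ [t, t+ℓ).  With t = s + d and 2(t+ℓ) ≤ m no wrap-around
-- occurs, and crossings(x) is the overlap of [x, x+ℓ) with [d, d+ℓ): the
-- tent function of height ℓ centred at d.  Since the fibres ρ⁻¹(f), f < m,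
-- are disjoint, the right-hand sums are also Σ_b α(b) · tent(ρ b).

open import Defs
open import Data.Nat using (ℕ; zero; suc; _+_; _*_; _∸_; _≤_; _<_; _⊓_; _⊔_; s≤s; z<s; s<s; NonZero; _≡ᵇ_)
open import Data.Nat.Properties
open import Data.Nat.DivMod using (_%_; m<n⇒m%n≡m; [m+n]%n≡m%n)
open import Data.Nat.ListAction using (sum)
open import Data.Nat.Tactic.RingSolver using (solve-∀)
open import Data.Bool using (Bool; true; false; if_then_else_; _∧_; T)
open import Data.Bool.ListAction using (any)
open import Data.Fin using (Fin; toℕ) renaming (zero to fzero; suc to fsuc)
open import Data.Fin.Properties using (toℕ<n)
open import Data.Fin.Subset using (Subset; _∉_; _∩_; ∣_∣)
open import Data.Fin.Subset.Properties using (_∈?_)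
open import Data.Fin.Permutation using (Permutation; permutation)
open import Data.Vec using ([]; _∷_; lookup)
open import Data.Vec.Properties using (lookup∘tabulate; lookup-zipWith)
open import Data.List as List using (map; upTo; applyUpTo; allFin)
open import Data.List.Properties using (map-tabulate; map-∘; map-upTo)
open import Data.List.Membership.Propositional using (_∈_; find; lose)
open import Data.List.Membership.Propositional.Properties using (∈-map⁺; ∈-map⁻; ∈-upTo⁺; ∈-upTo⁻)
open import Data.List.Relation.Unary.Any.Properties using (any⁺; any⁻)
open import Data.Product using (∃; _×_; _,_)
open import Function using (_∘_; id)
open import Relation.Nullary using (¬_; Dec; does; yes; no; contradiction)
open import Relation.Nullary.Decidable using (⌊_⌋; _×-dec_; dec-true; dec-false; T?; isYes≗does)
open import Relation.Binary.PropositionalEquality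
open import Algebra.Structures using (IsAbelianGroup)
open import Algebra.Properties.Semiring.Sum +-*-semiring
  using (sum-syntax; sum-cong-≗; ∑-comm; ∑-permute; ∑-distrib-+; *-distribˡ-sum; *-distribʳ-sum)

open ≡-Reasoning

ind : Bool → ℕ
ind b = if b then 1 else 0

ind-∧ : ∀ a b → ind (a ∧ b) ≡ ind a * ind b
ind-∧ true  b = sym (+-identityʳ (ind b))
ind-∧ false b = refl

does-cong : {P Q : Set} → (P → Q) → (Q → P) → (p? : Dec P) (q? : Dec Q) → does p? ≡ does q?
does-cong P→Q Q→P (yes p) (yes q) = refl
does-cong P→Q Q→P (yes p) (no ¬q) = contradiction (P→Q p) ¬q
does-cong P→Q Q→P (no ¬p) (yes q) = contradiction (Q→P q) ¬p
does-cong P→Q Q→P (no ¬p) (no ¬q) = refl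

inInterval? : ∀ p y q → Dec (p ≤ y × y < q)
inInterval? p y q = p ≤? y ×-dec y <? q

𝟙[_≤_<_] : ℕ → ℕ → ℕ → ℕ
𝟙[ p ≤ y < q ] = ind (does (inInterval? p y q))

𝟙-in : ∀ {p y q} → p ≤ y → y < q → 𝟙[ p ≤ y < q ] ≡ 1
𝟙-in {p} {y} {q} p≤y y<q = cong ind (dec-true (inInterval? p y q) (p≤y , y<q))

𝟙-out : ∀ {p y q} → ¬ (p ≤ y × y < q) → 𝟙[ p ≤ y < q ] ≡ 0
𝟙-out {p} {y} {q} y∉ = cong ind (dec-false (inInterval? p y q) y∉)

𝟙-below : ∀ {p y q} → y < p → 𝟙[ p ≤ y < q ] ≡ 0
𝟙-below {p} {y} {q} y<p = 𝟙-out {p} {y} {q} (λ (p≤y , _) → <⇒≱ y<p p≤y)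

𝟙-above : ∀ {p y q} → q ≤ y → 𝟙[ p ≤ y < q ] ≡ 0
𝟙-above {p} {y} {q} q≤y = 𝟙-out {p} {y} {q} (λ (_ , y<q) → ≤⇒≯ q≤y y<q)

𝟙-shift : ∀ c p y q → 𝟙[ c + p ≤ c + y < c + q ] ≡ 𝟙[ p ≤ y < q ]
𝟙-shift c p y q = cong ind (does-cong
  (λ (a , b) → +-cancelˡ-≤ c p y a , +-cancelˡ-< c y q b)
  (λ (a , b) → +-monoʳ-≤ c a , +-monoʳ-< c b)
  (inInterval? (c + p) (c + y) (c + q)) (inInterval? p y q))

𝟙-weighted : ∀ {p y q} w v → (p ≤ y → y < q → w ≡ v) → (¬ (p ≤ y × y < q) → v ≡ 0) →
             𝟙[ p ≤ y < q ] * w ≡ v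
𝟙-weighted {p} {y} {q} w v inside outside = go (inInterval? p y q)
  where
  go : (d : Dec (p ≤ y × y < q)) → ind (does d) * w ≡ v
  go (yes (p≤y , y<q)) = trans (+-identityʳ w) (inside p≤y y<q)
  go (no y∉)           = sym (outside y∉)

Σ< : ℕ → (ℕ → ℕ) → ℕ
Σ< zero    f = 0
Σ< (suc L) f = f 0 + Σ< L (f ∘ suc)

∑-Σ< : ∀ L (f : ℕ → ℕ) → ∑[ i < L ] f (toℕ i) ≡ Σ< L f
∑-Σ< zero    f = refl
∑-Σ< (suc L) f = cong (f 0 +_) (∑-Σ< L (f ∘ suc))

Σ<-cong : ∀ L {f g} → (∀ i → i < L → f i ≡ g i) → Σ< L f ≡ Σ< L g
Σ<-cong zero    f≗g = refl
Σ<-cong (suc L) f≗g = cong₂ _+_ (f≗g 0 z<s) (Σ<-cong L (λ i i<L → f≗g (suc i) (s<s i<L)))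

Σ<-zero : ∀ L {f} → (∀ i → i < L → f i ≡ 0) → Σ< L f ≡ 0
Σ<-zero zero    f≡0 = refl
Σ<-zero (suc L) f≡0 = cong₂ _+_ (f≡0 0 z<s) (Σ<-zero L (λ i i<L → f≡0 (suc i) (s<s i<L)))

Σ<-split : ∀ a b (f : ℕ → ℕ) → Σ< (a + b) f ≡ Σ< a f + Σ< b (λ i → f (a + i))
Σ<-split zero    b f = refl
Σ<-split (suc a) b f = trans (cong (f 0 +_) (Σ<-split a b (f ∘ suc))) (sym (+-assoc (f 0) _ _))

Σ<-point : ∀ L p {f} → p < L → (∀ i → i < L → i ≢ p → f i ≡ 0) → Σ< L f ≡ f p
Σ<-point (suc L) zero    {f} _ f≡0 =
  trans (cong (f 0 +_) (Σ<-zero L (λ i i<L → f≡0 (suc i) (s<s i<L) (λ ())))) (+-identityʳ (f 0))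
Σ<-point (suc L) (suc p) {f} (s<s p<L) f≡0 =
  trans (cong (_+ Σ< L (f ∘ suc)) (f≡0 0 z<s (λ ())))
        (Σ<-point L p p<L (λ i i<L i≢p → f≡0 (suc i) (s<s i<L) (i≢p ∘ suc-injective)))

Σ<-restrict : ∀ M p K (G : ℕ → ℕ) → p + K ≤ M →
              Σ< M (λ y → 𝟙[ p ≤ y < p + K ] * G y) ≡ Σ< K (λ i → G (p + i))
Σ<-restrict M p K G p+K≤M = begin
  Σ< M F                                                 ≡⟨ cong (λ N → Σ< N F) M≡p+K+r ⟨
  Σ< (p + (K + r)) F                                     ≡⟨ Σ<-split p (K + r) F ⟩
  Σ< p F + Σ< (K + r) (λ i → F (p + i))                  ≡⟨ cong₂ _+_ below (Σ<-split K r _) ⟩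
  Σ< K (λ i → F (p + i)) + Σ< r (λ i → F (p + (K + i))) ≡⟨ cong₂ _+_ inside above ⟩
  Σ< K (λ i → G (p + i)) + 0                             ≡⟨ +-identityʳ _ ⟩
  Σ< K (λ i → G (p + i))                                 ∎
  where
  F : ℕ → ℕ
  F y = 𝟙[ p ≤ y < p + K ] * G y
  r : ℕ
  r = M ∸ (p + K)
  M≡p+K+r : p + (K + r) ≡ M
  M≡p+K+r = trans (sym (+-assoc p K r)) (m+[n∸m]≡n p+K≤M)
  below : Σ< p F ≡ 0
  below = Σ<-zero p (λ y y<p → cong (_* G y) (𝟙-below {p} {y} {p + K} y<p))
  inside : Σ< K (λ i → F (p + i)) ≡ Σ< K (λ i → G (p + i))
  inside = Σ<-cong K (λ i i<K →
    trans (cong (_* G (p + i)) (𝟙-in {p} {p + i} {p + K} (m≤m+n p i) (+-monoʳ-< p i<K)))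
          (+-identityʳ (G (p + i))))
  above : Σ< r (λ i → F (p + (K + i))) ≡ 0
  above = Σ<-zero r (λ i _ → cong (_* G (p + (K + i)))
    (𝟙-above {p} {p + (K + i)} {p + K} (≤-trans (m≤m+n (p + K) i) (≤-reflexive (+-assoc p K i)))))

Σ<-* : ∀ L c (f : ℕ → ℕ) → Σ< L (λ i → c * f i) ≡ c * Σ< L f
Σ<-* zero    c f = sym (*-zeroʳ c)
Σ<-* (suc L) c f = trans (cong (c * f 0 +_) (Σ<-* L c (f ∘ suc))) (sym (*-distribˡ-+ c (f 0) _))

Σ<-∑-comm : ∀ L {n} (G : Fin n → ℕ → ℕ) → Σ< L (λ i → ∑[ b < n ] G b i) ≡ ∑[ b < n ] Σ< L (G b)
Σ<-∑-comm L {n} G = begin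
  Σ< L (λ i → ∑[ b < n ] G b i)           ≡⟨ ∑-Σ< L (λ i → ∑[ b < n ] G b i) ⟨
  ∑[ k < L ] ∑[ b < n ] G b (toℕ k)       ≡⟨ ∑-comm {L} {n} (λ k b → G b (toℕ k)) ⟩
  ∑[ b < n ] ∑[ k < L ] G b (toℕ k)       ≡⟨ sum-cong-≗ {n} (λ b → ∑-Σ< L (G b)) ⟩
  ∑[ b < n ] Σ< L (G b)                   ∎

∑-const : ∀ n c → ∑[ i < n ] c ≡ n * c
∑-const zero    c = refl
∑-const (suc n) c = cong (c +_) (∑-const n c)

sum-allFin : ∀ n (h : Fin n → ℕ) → sum (map h (allFin n)) ≡ ∑[ i < n ] h i
sum-allFin n h = trans (cong sum (map-tabulate id h)) (sum-tabulate h)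
  where
  sum-tabulate : ∀ {k} (f : Fin k → ℕ) → sum (List.tabulate f) ≡ ∑[ i < k ] f i
  sum-tabulate {zero}  f = refl
  sum-tabulate {suc k} f = cong (f fzero +_) (sum-tabulate (f ∘ fsuc))

sumRange-Σ< : ∀ D₁ D₂ (h : ℕ → ℕ) → sumRange D₁ D₂ h ≡ Σ< (D₂ ∸ D₁) (λ i → h (D₁ + i))
sumRange-Σ< D₁ D₂ h =
  trans (cong sum (trans (sym (map-∘ (upTo (D₂ ∸ D₁)))) (map-upTo (h ∘ (D₁ +_)) (D₂ ∸ D₁))))
        (sum-applyUpTo (D₂ ∸ D₁) (h ∘ (D₁ +_)))
  where
  sum-applyUpTo : ∀ K (f : ℕ → ℕ) → sum (applyUpTo f K) ≡ Σ< K f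
  sum-applyUpTo zero    f = refl
  sum-applyUpTo (suc K) f = cong (f 0 +_) (sum-applyUpTo K (f ∘ suc))

-- One step of the overlap count: the point c contributes exactly when it lies
-- in [p, q).  Here Q stands for the truncated right end q ⊓ (c + L + 1).
count-step : ∀ p q c Q → Q ≤ q → (c < q → c < Q) →
             𝟙[ p ≤ c < q ] + (Q ∸ (p ⊔ suc c)) ≡ Q ∸ (p ⊔ c)
count-step p q c Q Q≤q c<Q with c <? p
... | yes c<p = trans (cong₂ (λ u v → u + (Q ∸ v)) (𝟙-below {p} {c} {q} c<p) (m≥n⇒m⊔n≡m c<p))
                      (cong (Q ∸_) (sym (m≥n⇒m⊔n≡m (<⇒≤ c<p))))
... | no c≮p = begin
  𝟙[ p ≤ c < q ] + (Q ∸ (p ⊔ suc c)) ≡⟨ cong (λ v → 𝟙[ p ≤ c < q ] + (Q ∸ v)) (m≤n⇒m⊔n≡n (m≤n⇒m≤1+n p≤c)) ⟩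
  𝟙[ p ≤ c < q ] + (Q ∸ suc c)       ≡⟨ contribution (c <? q) ⟩
  Q ∸ c                               ≡⟨ cong (Q ∸_) (m≤n⇒m⊔n≡n p≤c) ⟨
  Q ∸ (p ⊔ c)                         ∎
  where
  p≤c : p ≤ c
  p≤c = ≮⇒≥ c≮p
  contribution : Dec (c < q) → 𝟙[ p ≤ c < q ] + (Q ∸ suc c) ≡ Q ∸ c
  contribution (yes c<q) = trans (cong (_+ (Q ∸ suc c)) (𝟙-in {p} {c} {q} p≤c c<q))
                                 (sym (+-∸-assoc 1 (c<Q c<q)))
  contribution (no c≮q)  = trans (cong₂ _+_ (𝟙-above {p} {c} {q} q≤c) (m≤n⇒m∸n≡0 (m≤n⇒m≤1+n Q≤c)))
                                 (sym (m≤n⇒m∸n≡0 Q≤c))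
    where
    q≤c : q ≤ c
    q≤c = ≮⇒≥ c≮q
    Q≤c : Q ≤ c
    Q≤c = ≤-trans Q≤q q≤c

count-in-interval : ∀ L p q c → Σ< L (λ i → 𝟙[ p ≤ c + i < q ]) ≡ q ⊓ (c + L) ∸ (p ⊔ c)
count-in-interval zero p q c =
  sym (m≤n⇒m∸n≡0 (≤-trans (m⊓n≤n q (c + 0)) (≤-trans (≤-reflexive (+-identityʳ c)) (m≤n⊔m p c))))
count-in-interval (suc L) p q c = begin
  𝟙[ p ≤ c + 0 < q ] + Σ< L (λ i → 𝟙[ p ≤ c + suc i < q ])
    ≡⟨ cong₂ _+_ (cong (λ y → 𝟙[ p ≤ y < q ]) (+-identityʳ c))
                 (Σ<-cong L (λ i _ → cong (λ y → 𝟙[ p ≤ y < q ]) (+-suc c i))) ⟩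
  𝟙[ p ≤ c < q ] + Σ< L (λ i → 𝟙[ p ≤ suc c + i < q ])
    ≡⟨ cong (𝟙[ p ≤ c < q ] +_) (count-in-interval L p q (suc c)) ⟩
  𝟙[ p ≤ c < q ] + (q ⊓ suc (c + L) ∸ (p ⊔ suc c))
    ≡⟨ count-step p q c (q ⊓ suc (c + L)) (m⊓n≤m q _) (λ c<q → ⊓-glb c<q (s≤s (m≤m+n c L))) ⟩
  q ⊓ suc (c + L) ∸ (p ⊔ c)
    ≡⟨ cong (λ e → q ⊓ e ∸ (p ⊔ c)) (+-suc c L) ⟨
  q ⊓ (c + suc L) ∸ (p ⊔ c) ∎

-- The tent function with support (d − ℓ, d + ℓ) and peak ℓ at d, as the sum
-- of its rising and falling flanks (the two weights of Lemma A.10).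
tent-rise tent-fall tent : ℕ → ℕ → ℕ → ℕ
tent-rise d ℓ x = 𝟙[ suc (d ∸ ℓ) ≤ x < d ] * (x ∸ (d ∸ ℓ))
tent-fall d ℓ x = 𝟙[ d ≤ x < d + ℓ ] * (d + ℓ ∸ x)
tent d ℓ x = tent-rise d ℓ x + tent-fall d ℓ x

overlap≡tent : ∀ d ℓ x → ℓ ≤ d → (d + ℓ) ⊓ (x + ℓ) ∸ (d ⊔ x) ≡ tent d ℓ x
overlap≡tent d ℓ x ℓ≤d with x <? d
... | yes x<d = begin
  (d + ℓ) ⊓ (x + ℓ) ∸ (d ⊔ x) ≡⟨ cong₂ _∸_ (m≥n⇒m⊓n≡n (+-monoˡ-≤ ℓ (<⇒≤ x<d))) (m≥n⇒m⊔n≡m (<⇒≤ x<d)) ⟩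
  x + ℓ ∸ d                     ≡⟨ 𝟙-weighted (x ∸ (d ∸ ℓ)) (x + ℓ ∸ d) (λ _ _ → rising) vanishing ⟨
  tent-rise d ℓ x               ≡⟨ +-identityʳ (tent-rise d ℓ x) ⟨
  tent-rise d ℓ x + 0           ≡⟨ cong (λ u → tent-rise d ℓ x + u * (d + ℓ ∸ x)) (𝟙-below {d} {x} {d + ℓ} x<d) ⟨
  tent d ℓ x                    ∎
  where
  rising : x ∸ (d ∸ ℓ) ≡ x + ℓ ∸ d
  rising = trans (sym ([m+n]∸[m+o]≡n∸o ℓ x (d ∸ ℓ))) (cong₂ _∸_ (+-comm ℓ x) (m+[n∸m]≡n ℓ≤d))
  vanishing : ¬ (suc (d ∸ ℓ) ≤ x × x < d) → x + ℓ ∸ d ≡ 0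
  vanishing x∉ = m≤n⇒m∸n≡0 (≤-trans (+-monoˡ-≤ ℓ (≮⇒≥ (λ lt → x∉ (lt , x<d)))) (≤-reflexive (m∸n+n≡m ℓ≤d)))
... | no x≮d = begin
  (d + ℓ) ⊓ (x + ℓ) ∸ (d ⊔ x) ≡⟨ cong₂ _∸_ (m≤n⇒m⊓n≡m (+-monoˡ-≤ ℓ d≤x)) (m≤n⇒m⊔n≡n d≤x) ⟩
  d + ℓ ∸ x                     ≡⟨ 𝟙-weighted (d + ℓ ∸ x) (d + ℓ ∸ x) (λ _ _ → refl) vanishing ⟨
  tent-fall d ℓ x               ≡⟨ cong (λ u → u * (x ∸ (d ∸ ℓ)) + tent-fall d ℓ x) (𝟙-above {suc (d ∸ ℓ)} {x} {d} d≤x) ⟨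
  tent d ℓ x                    ∎
  where
  d≤x : d ≤ x
  d≤x = ≮⇒≥ x≮d
  vanishing : ¬ (d ≤ x × x < d + ℓ) → d + ℓ ∸ x ≡ 0
  vanishing x∉ = m≤n⇒m∸n≡0 (≮⇒≥ (λ lt → x∉ (d≤x , lt)))

tent-far : ∀ d ℓ x → d + ℓ ≤ x → tent d ℓ x ≡ 0
tent-far d ℓ x d+ℓ≤x = cong₂ (λ u v → u * (x ∸ (d ∸ ℓ)) + v * (d + ℓ ∸ x))
  (𝟙-above {suc (d ∸ ℓ)} {x} {d} (≤-trans (m≤m+n d ℓ) d+ℓ≤x)) (𝟙-above {d} {x} {d + ℓ} d+ℓ≤x)

+<-of-<∸ : ∀ {D₁ D₂ i} → i < D₂ ∸ D₁ → D₁ + i < D₂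
+<-of-<∸ {D₁} {D₂} {i} i<K = subst (D₁ + i <_) (m+[n∸m]≡n (<⇒≤ D₁<D₂)) (+-monoʳ-< D₁ i<K)
  where
  D₁<D₂ : D₁ < D₂
  D₁<D₂ = m∸n≢0⇒n<m (λ K≡0 → n≮0 (subst (i <_) K≡0 i<K))

first-interval-fits : ∀ {M} s d ℓ → ℓ ≤ d → s + d + ℓ + ℓ ≤ M → s + ℓ ≤ M
first-interval-fits {M} s d ℓ ℓ≤d t+2ℓ≤M =
  ≤-trans (+-monoʳ-≤ s ℓ≤d) (≤-trans (m≤m+n (s + d) ℓ) (≤-trans (m≤m+n (s + d + ℓ) ℓ) t+2ℓ≤M))

module Residues (m : ℕ) .{{_ : NonZero m}} where

  Σ<-rotate : ∀ c (F : ℕ → ℕ) → c ≤ m → Σ< m (λ k → F ((c + k) % m)) ≡ Σ< m F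
  Σ<-rotate c F c≤m = begin
    Σ< m G                                     ≡⟨ cong (λ N → Σ< N G) (m∸n+n≡m c≤m) ⟨
    Σ< (m ∸ c + c) G                           ≡⟨ Σ<-split (m ∸ c) c G ⟩
    Σ< (m ∸ c) G + Σ< c (λ i → G (m ∸ c + i)) ≡⟨ cong₂ _+_ (Σ<-cong (m ∸ c) noWrap) (Σ<-cong c wrap) ⟩
    Σ< (m ∸ c) (λ i → F (c + i)) + Σ< c F     ≡⟨ +-comm _ (Σ< c F) ⟩
    Σ< c F + Σ< (m ∸ c) (λ i → F (c + i))     ≡⟨ Σ<-split c (m ∸ c) F ⟨
    Σ< (c + (m ∸ c)) F                         ≡⟨ cong (λ N → Σ< N F) (m+[n∸m]≡n c≤m) ⟩
    Σ< m F                                     ∎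
    where
    G : ℕ → ℕ
    G k = F ((c + k) % m)
    noWrap : ∀ i → i < m ∸ c → G i ≡ F (c + i)
    noWrap i i<m∸c = cong F (m<n⇒m%n≡m (+<-of-<∸ i<m∸c))
    wrap : ∀ i → i < c → G (m ∸ c + i) ≡ F i
    wrap i i<c = cong F (begin
      (c + (m ∸ c + i)) % m ≡⟨ cong (_% m) (trans (sym (+-assoc c (m ∸ c) i)) (cong (_+ i) (m+[n∸m]≡n c≤m))) ⟩
      (m + i) % m           ≡⟨ cong (_% m) (+-comm m i) ⟩
      (i + m) % m           ≡⟨ [m+n]%n≡m%n i m ⟩
      i % m                 ≡⟨ m<n⇒m%n≡m (<-≤-trans i<c c≤m) ⟩
      i                     ∎)

  sift : ∀ D₁ D₂ x (w : ℕ → ℕ) → D₂ ≤ m →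
         Σ< (D₂ ∸ D₁) (λ i → ind (x ≡ᵇ (D₁ + i) % m) * w (D₁ + i)) ≡ 𝟙[ D₁ ≤ x < D₂ ] * w x
  sift D₁ D₂ x w D₂≤m = sym (𝟙-weighted (w x) (Σ< (D₂ ∸ D₁) term) inside outside)
    where
    term : ℕ → ℕ
    term i = ind (x ≡ᵇ (D₁ + i) % m) * w (D₁ + i)
    reduced : ∀ i → i < D₂ ∸ D₁ → (D₁ + i) % m ≡ D₁ + i
    reduced i i<K = m<n⇒m%n≡m (<-≤-trans (+<-of-<∸ i<K) D₂≤m)
    off : ∀ i → i < D₂ ∸ D₁ → x ≢ D₁ + i → term i ≡ 0
    off i i<K x≢ = cong (λ b → ind b * w (D₁ + i))
      (dec-false (x ≟ (D₁ + i) % m) (λ x≡ → x≢ (trans x≡ (reduced i i<K))))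
    inside : D₁ ≤ x → x < D₂ → w x ≡ Σ< (D₂ ∸ D₁) term
    inside D₁≤x x<D₂ = sym (begin
      Σ< (D₂ ∸ D₁) term  ≡⟨ Σ<-point (D₂ ∸ D₁) p p<K only-p ⟩
      term p             ≡⟨ cong (λ b → ind b * w (D₁ + p)) (dec-true (x ≟ (D₁ + p) % m) x≡D₁+p) ⟩
      w (D₁ + p) + 0     ≡⟨ +-identityʳ (w (D₁ + p)) ⟩
      w (D₁ + p)         ≡⟨ cong w D₁+p≡x ⟩
      w x                ∎)
      where
      p : ℕ
      p = x ∸ D₁
      p<K : p < D₂ ∸ D₁
      p<K = ∸-monoˡ-< x<D₂ D₁≤x
      D₁+p≡x : D₁ + p ≡ x
      D₁+p≡x = m+[n∸m]≡n D₁≤x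
      x≡D₁+p : x ≡ (D₁ + p) % m
      x≡D₁+p = sym (trans (reduced p p<K) D₁+p≡x)
      only-p : ∀ i → i < D₂ ∸ D₁ → i ≢ p → term i ≡ 0
      only-p i i<K i≢p = off i i<K (λ x≡D₁+i → i≢p (+-cancelˡ-≡ D₁ i p (trans (sym x≡D₁+i) (sym D₁+p≡x))))
    outside : ¬ (D₁ ≤ x × x < D₂) → Σ< (D₂ ∸ D₁) term ≡ 0
    outside x∉ = Σ<-zero (D₂ ∸ D₁) (λ i i<K → off i i<K (λ x≡ →
      x∉ (subst (D₁ ≤_) (sym x≡) (m≤m+n D₁ i) , subst (_< D₂) (sym x≡) (+<-of-<∸ i<K))))

  any-range : ∀ D₁ D₂ y → D₂ ≤ m →
              any (λ f → y ≡ᵇ f % m) (range D₁ D₂) ≡ does (inInterval? D₁ y D₂)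
  any-range D₁ D₂ y D₂≤m = does-cong to from (T? (any P (range D₁ D₂))) (inInterval? D₁ y D₂)
    where
    P : ℕ → Bool
    P f = y ≡ᵇ f % m
    to : T (any P (range D₁ D₂)) → D₁ ≤ y × y < D₂
    to anyP with find (any⁻ P (range D₁ D₂) anyP)
    ... | f , f∈ , Pf with ∈-map⁻ (D₁ +_) f∈
    ...   | i , i∈ , refl = subst (D₁ ≤_) (sym y≡) (m≤m+n D₁ i) , subst (_< D₂) (sym y≡) D₁+i<D₂
      where
      D₁+i<D₂ : D₁ + i < D₂
      D₁+i<D₂ = +<-of-<∸ (∈-upTo⁻ i∈)
      y≡ : y ≡ D₁ + i
      y≡ = trans (≡ᵇ⇒≡ y _ Pf) (m<n⇒m%n≡m (<-≤-trans D₁+i<D₂ D₂≤m))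
    from : D₁ ≤ y × y < D₂ → T (any P (range D₁ D₂))
    from (D₁≤y , y<D₂) = any⁺ P (lose y∈ Py)
      where
      y∈ : y ∈ range D₁ D₂
      y∈ = subst (_∈ range D₁ D₂) (m+[n∸m]≡n D₁≤y) (∈-map⁺ (D₁ +_) (∈-upTo⁺ (∸-monoˡ-< y<D₂ D₁≤y)))
      Py : T (P y)
      Py = ≡⇒≡ᵇ y (y % m) (sym (m<n⇒m%n≡m (<-≤-trans y<D₂ D₂≤m)))

  %-wrap : ∀ {z} → m ≤ z → z ∸ m < m → z % m ≡ z ∸ m
  %-wrap {z} m≤z z∸m<m = begin
    z % m           ≡⟨ cong (_% m) (m∸n+n≡m m≤z) ⟨
    (z ∸ m + m) % m ≡⟨ [m+n]%n≡m%n (z ∸ m) m ⟩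
    (z ∸ m) % m     ≡⟨ m<n⇒m%n≡m z∸m<m ⟩
    z ∸ m           ∎

  crossings : ℕ → ℕ → ℕ → ℕ → ℕ
  crossings s t ℓ x = Σ< m (λ y → 𝟙[ s ≤ y < s + ℓ ] * 𝟙[ t ≤ (x + y) % m < t + ℓ ])

  crossings-restrict : ∀ s t ℓ x → s + ℓ ≤ m →
    crossings s t ℓ x ≡ Σ< ℓ (λ i → 𝟙[ t ≤ (x + (s + i)) % m < t + ℓ ])
  crossings-restrict s t ℓ x s+ℓ≤m = Σ<-restrict m s ℓ (λ y → 𝟙[ t ≤ (x + y) % m < t + ℓ ]) s+ℓ≤m

  -- For t = s + d and x < d + ℓ nothing wraps around modulo m, and crossings
  -- counts the overlap of [x, x + ℓ) with [d, d + ℓ).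
  crossings-near : ∀ s d ℓ x → ℓ ≤ d → s + d + ℓ + ℓ ≤ m → x < d + ℓ →
                   crossings s (s + d) ℓ x ≡ (d + ℓ) ⊓ (x + ℓ) ∸ (d ⊔ x)
  crossings-near s d ℓ x ℓ≤d t+2ℓ≤m x<d+ℓ = begin
    crossings s (s + d) ℓ x
      ≡⟨ crossings-restrict s (s + d) ℓ x (first-interval-fits s d ℓ ℓ≤d t+2ℓ≤m) ⟩
    Σ< ℓ (λ i → 𝟙[ s + d ≤ (x + (s + i)) % m < s + d + ℓ ])
      ≡⟨ Σ<-cong ℓ unshift ⟩
    Σ< ℓ (λ i → 𝟙[ d ≤ x + i < d + ℓ ])
      ≡⟨ count-in-interval ℓ d (d + ℓ) x ⟩
    (d + ℓ) ⊓ (x + ℓ) ∸ (d ⊔ x) ∎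
    where
    shuffle : ∀ a b c → a + (b + c) ≡ b + (a + c)
    shuffle = solve-∀
    regroup : ∀ a b c → a + b + (c + b) ≡ c + a + b + b
    regroup = solve-∀
    unshift : ∀ i → i < ℓ → 𝟙[ s + d ≤ (x + (s + i)) % m < s + d + ℓ ] ≡ 𝟙[ d ≤ x + i < d + ℓ ]
    unshift i i<ℓ = begin
      𝟙[ s + d ≤ (x + (s + i)) % m < s + d + ℓ ]
        ≡⟨ cong₂ (λ y q → 𝟙[ s + d ≤ y < q ]) (trans (m<n⇒m%n≡m z<m) (shuffle x s i)) (+-assoc s d ℓ) ⟩
      𝟙[ s + d ≤ s + (x + i) < s + (d + ℓ) ]
        ≡⟨ 𝟙-shift s d (x + i) (d + ℓ) ⟩
      𝟙[ d ≤ x + i < d + ℓ ] ∎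
      where
      z<m : x + (s + i) < m
      z<m = <-≤-trans (subst (x + (s + i) <_) (regroup d ℓ s) (+-mono-< x<d+ℓ (+-monoʳ-< s i<ℓ))) t+2ℓ≤m

  -- For t = s + d and x ≥ d + ℓ, every x + y with y ∈ [s, s + ℓ) lands either
  -- above t + ℓ or, after wrapping around, below s + ℓ ≤ t.
  crossings-far : ∀ s d ℓ x → ℓ ≤ d → s + d + ℓ + ℓ ≤ m → d + ℓ ≤ x → x < m →
                  crossings s (s + d) ℓ x ≡ 0
  crossings-far s d ℓ x ℓ≤d t+2ℓ≤m d+ℓ≤x x<m =
    trans (crossings-restrict s (s + d) ℓ x s+ℓ≤m) (Σ<-zero ℓ (λ i i<ℓ → miss i i<ℓ (x + (s + i) <? m)))
    where
    s+ℓ≤m : s + ℓ ≤ m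
    s+ℓ≤m = first-interval-fits s d ℓ ℓ≤d t+2ℓ≤m
    regroup : ∀ a b c → a + b + c ≡ c + a + b
    regroup = solve-∀
    miss : ∀ i → i < ℓ → Dec (x + (s + i) < m) → 𝟙[ s + d ≤ (x + (s + i)) % m < s + d + ℓ ] ≡ 0
    miss i i<ℓ (yes z<m) = trans (cong (λ y → 𝟙[ s + d ≤ y < s + d + ℓ ]) (m<n⇒m%n≡m z<m))
      (𝟙-above {s + d} {x + (s + i)} {s + d + ℓ}
        (subst (_≤ x + (s + i)) (regroup d ℓ s) (+-mono-≤ d+ℓ≤x (m≤m+n s i))))
    miss i i<ℓ (no z≮m) = trans (cong (λ y → 𝟙[ s + d ≤ y < s + d + ℓ ]) (%-wrap m≤z (<-≤-trans z∸m<s+ℓ s+ℓ≤m)))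
      (𝟙-below {s + d} {x + (s + i) ∸ m} {s + d + ℓ} (<-≤-trans z∸m<s+ℓ (+-monoʳ-≤ s ℓ≤d)))
      where
      m≤z : m ≤ x + (s + i)
      m≤z = ≮⇒≥ z≮m
      z∸m<s+ℓ : x + (s + i) ∸ m < s + ℓ
      z∸m<s+ℓ = subst (x + (s + i) ∸ m <_) (m+n∸m≡n m (s + ℓ))
                  (∸-monoˡ-< (+-mono-< x<m (+-monoʳ-< s i<ℓ)) m≤z)

  crossings≡tent : ∀ s d ℓ x → ℓ ≤ d → s + d + ℓ + ℓ ≤ m → x < m →
                   crossings s (s + d) ℓ x ≡ tent d ℓ x
  crossings≡tent s d ℓ x ℓ≤d t+2ℓ≤m x<m with x <? d + ℓ
  ... | yes x<d+ℓ = trans (crossings-near s d ℓ x ℓ≤d t+2ℓ≤m x<d+ℓ) (overlap≡tent d ℓ x ℓ≤d)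
  ... | no x≮d+ℓ  = trans (crossings-far s d ℓ x ℓ≤d t+2ℓ≤m (≮⇒≥ x≮d+ℓ) x<m) (sym (tent-far d ℓ x (≮⇒≥ x≮d+ℓ)))

∈?-lookup : ∀ {n} (i : Fin n) (p : Subset n) → does (i ∈? p) ≡ lookup p i
∈?-lookup fzero    (true  ∷ p) = refl
∈?-lookup fzero    (false ∷ p) = refl
∈?-lookup (fsuc i) (b     ∷ p) = ∈?-lookup i p

inSet : ∀ {n} → Subset n → Fin n → ℕ
inSet p i = ind (lookup p i)

∣∣-sum : ∀ {n} (p : Subset n) → ∣ p ∣ ≡ ∑[ i < n ] inSet p i
∣∣-sum []          = refl
∣∣-sum (true  ∷ p) = cong suc (∣∣-sum p)
∣∣-sum (false ∷ p) = ∣∣-sum p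

module GroupSums {n : ℕ} (Γ : FinAbGroup n) where
  open FinAbGroup Γ
  open IsAbelianGroup isAbelianGroup using (assoc; identityʳ; inverseˡ; inverseʳ)

  ∙-⁻¹-cancel : ∀ x h → (x ∙ h) ∙ h ⁻¹ ≡ x
  ∙-⁻¹-cancel x h = trans (assoc x h (h ⁻¹)) (trans (cong (x ∙_) (inverseʳ h)) (identityʳ x))

  ⁻¹-∙-cancel : ∀ x h → (x ∙ h ⁻¹) ∙ h ≡ x
  ⁻¹-∙-cancel x h = trans (assoc x (h ⁻¹) h) (trans (cong (x ∙_) (inverseˡ h)) (identityʳ x))

  translation : Fin n → Permutation n n
  translation h = permutation (_∙ h) (_∙ h ⁻¹) (λ y → ⁻¹-∙-cancel y h) (λ x → ∙-⁻¹-cancel x h)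

  ∑-translate : ∀ h (F : Fin n → ℕ) → ∑[ g < n ] F g ≡ ∑[ g < n ] F (g ∙ h)
  ∑-translate h F = ∑-permute F (translation h)

  edges-by-difference : ∀ A U W →
    edges Γ A U W ≡ ∑[ b < n ] (inSet A b * ∑[ g < n ] (inSet U g * inSet W (b ∙ g)))
  edges-by-difference A U W = begin
    edges Γ A U W
      ≡⟨ trans (sum-allFin n _) (sum-cong-≗ {n} (λ g → trans (sum-allFin n _) (sum-cong-≗ {n} (edge g)))) ⟩
    ∑[ g < n ] ∑[ g' < n ] (inSet U g * (inSet W g' * inSet A (g' ∙ g ⁻¹)))
      ≡⟨ sum-cong-≗ {n} (λ g → ∑-translate g (λ g' → inSet U g * (inSet W g' * inSet A (g' ∙ g ⁻¹)))) ⟩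
    ∑[ g < n ] ∑[ b < n ] (inSet U g * (inSet W (b ∙ g) * inSet A ((b ∙ g) ∙ g ⁻¹)))
      ≡⟨ sum-cong-≗ {n} (λ g → sum-cong-≗ {n} (λ b → regroup g b)) ⟩
    ∑[ g < n ] ∑[ b < n ] (inSet A b * (inSet U g * inSet W (b ∙ g)))
      ≡⟨ ∑-comm {n} {n} (λ g b → inSet A b * (inSet U g * inSet W (b ∙ g))) ⟩
    ∑[ b < n ] ∑[ g < n ] (inSet A b * (inSet U g * inSet W (b ∙ g)))
      ≡⟨ sum-cong-≗ {n} (λ b → *-distribˡ-sum (inSet A b) (λ g → inSet U g * inSet W (b ∙ g))) ⟨
    ∑[ b < n ] (inSet A b * ∑[ g < n ] (inSet U g * inSet W (b ∙ g))) ∎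
    where
    member : ∀ g (p : Subset n) → ind ⌊ g ∈? p ⌋ ≡ inSet p g
    member g p = cong ind (trans (isYes≗does (g ∈? p)) (∈?-lookup g p))
    edge : ∀ g g' → ind (⌊ g ∈? U ⌋ ∧ ⌊ g' ∈? W ⌋ ∧ adjᵇ Γ A g g')
                    ≡ inSet U g * (inSet W g' * inSet A (g' ∙ g ⁻¹))
    edge g g' = begin
      ind (⌊ g ∈? U ⌋ ∧ ⌊ g' ∈? W ⌋ ∧ adjᵇ Γ A g g')
        ≡⟨ ind-∧ ⌊ g ∈? U ⌋ (⌊ g' ∈? W ⌋ ∧ adjᵇ Γ A g g') ⟩
      ind ⌊ g ∈? U ⌋ * ind (⌊ g' ∈? W ⌋ ∧ adjᵇ Γ A g g')
        ≡⟨ cong (ind ⌊ g ∈? U ⌋ *_) (ind-∧ ⌊ g' ∈? W ⌋ (adjᵇ Γ A g g')) ⟩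
      ind ⌊ g ∈? U ⌋ * (ind ⌊ g' ∈? W ⌋ * ind ⌊ g' ∙ g ⁻¹ ∈? A ⌋)
        ≡⟨ cong₂ _*_ (member g U) (cong₂ _*_ (member g' W) (member (g' ∙ g ⁻¹) A)) ⟩
      inSet U g * (inSet W g' * inSet A (g' ∙ g ⁻¹)) ∎
    rotate : ∀ u w a → u * (w * a) ≡ a * (u * w)
    rotate = solve-∀
    regroup : ∀ g b → inSet U g * (inSet W (b ∙ g) * inSet A ((b ∙ g) ∙ g ⁻¹))
                      ≡ inSet A b * (inSet U g * inSet W (b ∙ g))
    regroup g b = trans (cong (λ a → inSet U g * (inSet W (b ∙ g) * inSet A a)) (∙-⁻¹-cancel b g))
                        (rotate (inSet U g) (inSet W (b ∙ g)) (inSet A b))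

module CayleyCount {n : ℕ} (Γ : FinAbGroup n) (A : Subset n) (m : ℕ) .{{_ : NonZero m}}
                   (ρ : Fin n → Fin m) (hom : IsHomToZmod Γ m ρ) (surj : ∀ k → ∃ λ g → ρ g ≡ k) where
  open FinAbGroup Γ using (_∙_)
  open GroupSums Γ
  open Residues m

  ρℕ : Fin n → ℕ
  ρℕ g = toℕ (ρ g)

  -- The fibres of the surjective homomorphism ρ all have n/m elements: for
  -- each residue k, translating by some h with ρ(h) = k turns the sum over Γ
  -- into the same sum with all residues shifted by k.
  equidistribution : ∀ (F : ℕ → ℕ) → m * ∑[ g < n ] F (ρℕ g) ≡ n * Σ< m F
  equidistribution F = begin
    m * X                                               ≡⟨ ∑-const m X ⟨
    ∑[ k < m ] X                                        ≡⟨ sum-cong-≗ {m} shifted ⟩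
    ∑[ k < m ] ∑[ g < n ] F ((ρℕ g + toℕ k) % m)        ≡⟨ ∑-comm {m} {n} (λ k g → F ((ρℕ g + toℕ k) % m)) ⟩
    ∑[ g < n ] ∑[ k < m ] F ((ρℕ g + toℕ k) % m)        ≡⟨ sum-cong-≗ {n} rotated ⟩
    ∑[ g < n ] Σ< m F                                   ≡⟨ ∑-const n (Σ< m F) ⟩
    n * Σ< m F                                          ∎
    where
    X : ℕ
    X = ∑[ g < n ] F (ρℕ g)
    shifted : ∀ k → X ≡ ∑[ g < n ] F ((ρℕ g + toℕ k) % m)
    shifted k with surj k
    ... | h , ρh≡k = trans (∑-translate h (λ g → F (ρℕ g)))
                           (sum-cong-≗ {n} (λ g → cong F (trans (hom g h) (cong (λ r → (ρℕ g + toℕ r) % m) ρh≡k))))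
    rotated : ∀ g → ∑[ k < m ] F ((ρℕ g + toℕ k) % m) ≡ Σ< m F
    rotated g = trans (∑-Σ< m (λ k → F ((ρℕ g + k) % m))) (Σ<-rotate (ρℕ g) F (<⇒≤ (toℕ<n (ρ g))))

  inSet-preimageRange : ∀ D₁ D₂ g → D₂ ≤ m → inSet (preimageRange ρ D₁ D₂) g ≡ 𝟙[ D₁ ≤ ρℕ g < D₂ ]
  inSet-preimageRange D₁ D₂ g D₂≤m =
    cong ind (trans (lookup∘tabulate (λ γ → any (λ f → ρℕ γ ≡ᵇ f % m) (range D₁ D₂)) g)
                    (any-range D₁ D₂ (ρℕ g) D₂≤m))

  edges-crossings : ∀ s t ℓ → s + ℓ ≤ m → t + ℓ ≤ m →
    m * edges Γ A (preimageRange ρ s (s + ℓ)) (preimageRange ρ t (t + ℓ))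
      ≡ n * ∑[ b < n ] (inSet A b * crossings s t ℓ (ρℕ b))
  edges-crossings s t ℓ s+ℓ≤m t+ℓ≤m = begin
    m * edges Γ A U W                                       ≡⟨ cong (m *_) (edges-by-difference A U W) ⟩
    m * ∑[ b < n ] (inSet A b * S b)                        ≡⟨ *-distribˡ-sum m (λ b → inSet A b * S b) ⟩
    ∑[ b < n ] (m * (inSet A b * S b))                      ≡⟨ sum-cong-≗ {n} per-difference ⟩
    ∑[ b < n ] (n * (inSet A b * C b))                      ≡⟨ *-distribˡ-sum n (λ b → inSet A b * C b) ⟨
    n * ∑[ b < n ] (inSet A b * C b)                        ∎
    where
    U W : Subset n
    U = preimageRange ρ s (s + ℓ)
    W = preimageRange ρ t (t + ℓ)
    S : Fin n → ℕ
    S b = ∑[ g < n ] (inSet U g * inSet W (b ∙ g))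
    G : Fin n → ℕ → ℕ
    G b y = 𝟙[ s ≤ y < s + ℓ ] * 𝟙[ t ≤ (ρℕ b + y) % m < t + ℓ ]
    C : Fin n → ℕ
    C b = crossings s t ℓ (ρℕ b)
    S-by-residue : ∀ b → S b ≡ ∑[ g < n ] G b (ρℕ g)
    S-by-residue b = sum-cong-≗ {n} (λ g → cong₂ _*_
      (inSet-preimageRange s (s + ℓ) g s+ℓ≤m)
      (trans (inSet-preimageRange t (t + ℓ) (b ∙ g) t+ℓ≤m) (cong (λ z → 𝟙[ t ≤ z < t + ℓ ]) (hom b g))))
    swap : ∀ x y z → x * (y * z) ≡ y * (x * z)
    swap = solve-∀
    per-difference : ∀ b → m * (inSet A b * S b) ≡ n * (inSet A b * C b)
    per-difference b = begin
      m * (inSet A b * S b)                      ≡⟨ swap m (inSet A b) (S b) ⟩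
      inSet A b * (m * S b)                      ≡⟨ cong (λ X → inSet A b * (m * X)) (S-by-residue b) ⟩
      inSet A b * (m * ∑[ g < n ] G b (ρℕ g))    ≡⟨ cong (inSet A b *_) (equidistribution (G b)) ⟩
      inSet A b * (n * C b)                      ≡⟨ swap (inSet A b) n (C b) ⟩
      n * (inSet A b * C b)                      ∎

  ∣A∩preimage∣ : ∀ f → ∣ A ∩ preimage ρ f ∣ ≡ ∑[ b < n ] (inSet A b * ind (ρℕ b ≡ᵇ f % m))
  ∣A∩preimage∣ f = trans (∣∣-sum (A ∩ preimage ρ f)) (sum-cong-≗ {n} (λ b → trans
    (cong ind (trans (lookup-zipWith _∧_ b A (preimage ρ f))
                     (cong (lookup A b ∧_) (lookup∘tabulate (λ γ → ρℕ γ ≡ᵇ f % m) b))))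
    (ind-∧ (lookup A b) (ρℕ b ≡ᵇ f % m))))

  -- The right-hand sums: Σ_{D₁ ≤ f < D₂} |A ∩ ρ⁻¹(f)| · w(f) counts each b ∈ A
  -- with weight w(ρ b) if ρ b ∈ [D₁, D₂), since the fibres are disjoint.
  weighted-fibres : ∀ D₁ D₂ (w : ℕ → ℕ) → D₂ ≤ m →
    sumRange D₁ D₂ (λ f → ∣ A ∩ preimage ρ f ∣ * w f)
      ≡ ∑[ b < n ] (inSet A b * (𝟙[ D₁ ≤ ρℕ b < D₂ ] * w (ρℕ b)))
  weighted-fibres D₁ D₂ w D₂≤m = begin
    sumRange D₁ D₂ (λ f → ∣ A ∩ preimage ρ f ∣ * w f)
      ≡⟨ sumRange-Σ< D₁ D₂ (λ f → ∣ A ∩ preimage ρ f ∣ * w f) ⟩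
    Σ< K (λ i → ∣ A ∩ preimage ρ (D₁ + i) ∣ * w (D₁ + i))
      ≡⟨ Σ<-cong K (λ i _ → expand (D₁ + i)) ⟩
    Σ< K (λ i → ∑[ b < n ] (inSet A b * δw b (D₁ + i)))
      ≡⟨ Σ<-∑-comm K (λ b i → inSet A b * δw b (D₁ + i)) ⟩
    ∑[ b < n ] Σ< K (λ i → inSet A b * δw b (D₁ + i))
      ≡⟨ sum-cong-≗ {n} (λ b → Σ<-* K (inSet A b) (λ i → δw b (D₁ + i))) ⟩
    ∑[ b < n ] (inSet A b * Σ< K (λ i → δw b (D₁ + i)))
      ≡⟨ sum-cong-≗ {n} (λ b → cong (inSet A b *_) (sift D₁ D₂ (ρℕ b) w D₂≤m)) ⟩
    ∑[ b < n ] (inSet A b * (𝟙[ D₁ ≤ ρℕ b < D₂ ] * w (ρℕ b))) ∎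
    where
    K : ℕ
    K = D₂ ∸ D₁
    δw : Fin n → ℕ → ℕ
    δw b f = ind (ρℕ b ≡ᵇ f % m) * w f
    expand : ∀ f → ∣ A ∩ preimage ρ f ∣ * w f ≡ ∑[ b < n ] (inSet A b * δw b f)
    expand f = begin
      ∣ A ∩ preimage ρ f ∣ * w f                                ≡⟨ cong (_* w f) (∣A∩preimage∣ f) ⟩
      ∑[ b < n ] (inSet A b * δ b) * w f                        ≡⟨ *-distribʳ-sum (w f) (λ b → inSet A b * δ b) ⟩
      ∑[ b < n ] (inSet A b * δ b * w f)                        ≡⟨ sum-cong-≗ {n} (λ b → *-assoc (inSet A b) (δ b) (w f)) ⟩
      ∑[ b < n ] (inSet A b * δw b f)                          ∎
      where
      δ : Fin n → ℕ
      δ b = ind (ρℕ b ≡ᵇ f % m)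

  -- Lemma A.10 with t written as s + d.
  edge-count : ∀ ℓ s d → ℓ ≤ d → s + d + ℓ + ℓ ≤ m →
    m * edges Γ A (preimageRange ρ s (s + ℓ)) (preimageRange ρ (s + d) (s + d + ℓ))
      ≡ n * (sumRange (suc (d ∸ ℓ)) d (λ f → ∣ A ∩ preimage ρ f ∣ * (f ∸ (d ∸ ℓ)))
             + sumRange d (d + ℓ) (λ f → ∣ A ∩ preimage ρ f ∣ * ((d + ℓ) ∸ f)))
  edge-count ℓ s d ℓ≤d t+2ℓ≤m = begin
    m * edges Γ A (preimageRange ρ s (s + ℓ)) (preimageRange ρ (s + d) (s + d + ℓ))
      ≡⟨ edges-crossings s (s + d) ℓ (first-interval-fits s d ℓ ℓ≤d t+2ℓ≤m) t+ℓ≤m ⟩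
    n * ∑[ b < n ] (inSet A b * crossings s (s + d) ℓ (ρℕ b))
      ≡⟨ cong (n *_) (sum-cong-≗ {n} (λ b → cong (inSet A b *_) (crossings-tent b))) ⟩
    n * ∑[ b < n ] (inSet A b * tent d ℓ (ρℕ b))
      ≡⟨ cong (n *_) (trans (sum-cong-≗ {n} flanks) (∑-distrib-+ {n} _ _)) ⟩
    n * (∑[ b < n ] (inSet A b * tent-rise d ℓ (ρℕ b)) + ∑[ b < n ] (inSet A b * tent-fall d ℓ (ρℕ b)))
      ≡⟨ cong (n *_) (cong₂ _+_ (weighted-fibres (suc (d ∸ ℓ)) d (λ f → f ∸ (d ∸ ℓ)) d≤m)
                                (weighted-fibres d (d + ℓ) (λ f → d + ℓ ∸ f) d+ℓ≤m)) ⟨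
    n * (sumRange (suc (d ∸ ℓ)) d (λ f → ∣ A ∩ preimage ρ f ∣ * (f ∸ (d ∸ ℓ)))
         + sumRange d (d + ℓ) (λ f → ∣ A ∩ preimage ρ f ∣ * ((d + ℓ) ∸ f))) ∎
    where
    crossings-tent : ∀ b → crossings s (s + d) ℓ (ρℕ b) ≡ tent d ℓ (ρℕ b)
    crossings-tent b = crossings≡tent s d ℓ (ρℕ b) ℓ≤d t+2ℓ≤m (toℕ<n (ρ b))
    flanks : ∀ b → inSet A b * tent d ℓ (ρℕ b) ≡ inSet A b * tent-rise d ℓ (ρℕ b) + inSet A b * tent-fall d ℓ (ρℕ b)
    flanks b = *-distribˡ-+ (inSet A b) (tent-rise d ℓ (ρℕ b)) (tent-fall d ℓ (ρℕ b))
    t+ℓ≤m : s + d + ℓ ≤ m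
    t+ℓ≤m = ≤-trans (m≤m+n (s + d + ℓ) ℓ) t+2ℓ≤m
    d+ℓ≤m : d + ℓ ≤ m
    d+ℓ≤m = ≤-trans (+-monoˡ-≤ ℓ (m≤n+m d s)) t+ℓ≤m
    d≤m : d ≤ m
    d≤m = ≤-trans (m≤m+n d ℓ) d+ℓ≤m

-- The theorem: edge-count with d = t − s.
lemmaA10 : (n : ℕ) (Γ : FinAbGroup n) (A : Subset n) →
    Symmetric Γ A → FinAbGroup.ε Γ ∉ A →
    (m : ℕ) .{{_ : NonZero m}} → 2 ≤ m →
    (ρ : Fin n → Fin m) → IsHomToZmod Γ m ρ → (∀ k → ∃ λ g → ρ g ≡ k) →
    (ℓ s t : ℕ) → s < s + ℓ → s + ℓ ≤ t → t < t + ℓ → 2 * (t + ℓ) ≤ m →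
    m * edges Γ A (preimageRange ρ s (s + ℓ)) (preimageRange ρ t (t + ℓ))
      ≡ n * (sumRange (suc (t ∸ s ∸ ℓ)) (t ∸ s)
                (λ f → ∣ A ∩ preimage ρ f ∣ * (f ∸ (t ∸ s ∸ ℓ)))
             + sumRange (t ∸ s) (t ∸ s + ℓ)
                (λ f → ∣ A ∩ preimage ρ f ∣ * ((t ∸ s + ℓ) ∸ f)))
lemmaA10 n Γ A _ _ m _ ρ hom surj ℓ s t _ s+ℓ≤t _ 2[t+ℓ]≤m =
  subst (λ u → m * edges Γ A (preimageRange ρ s (s + ℓ)) (preimageRange ρ u (u + ℓ)) ≡ tentSums)
        s+d≡t
        (CayleyCount.edge-count Γ A m ρ hom surj ℓ s (t ∸ s) ℓ≤d t+2ℓ≤m)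
  where
  tentSums : ℕ
  tentSums = n * (sumRange (suc (t ∸ s ∸ ℓ)) (t ∸ s) (λ f → ∣ A ∩ preimage ρ f ∣ * (f ∸ (t ∸ s ∸ ℓ)))
                  + sumRange (t ∸ s) (t ∸ s + ℓ) (λ f → ∣ A ∩ preimage ρ f ∣ * ((t ∸ s + ℓ) ∸ f)))
  s+d≡t : s + (t ∸ s) ≡ t
  s+d≡t = m+[n∸m]≡n (≤-trans (m≤m+n s ℓ) s+ℓ≤t)
  ℓ≤d : ℓ ≤ t ∸ s
  ℓ≤d = subst (_≤ t ∸ s) (m+n∸m≡n s ℓ) (∸-monoˡ-≤ s s+ℓ≤t)
  t+2ℓ≤m : s + (t ∸ s) + ℓ + ℓ ≤ m
  t+2ℓ≤m = subst (λ u → u + ℓ + ℓ ≤ m) (sym s+d≡t)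
             (≤-trans (+-monoʳ-≤ (t + ℓ) (≤-trans (m≤n+m ℓ t) (m≤m+n (t + ℓ) 0))) 2[t+ℓ]≤m)
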